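{- Let $G=(V,E)$ be a (simple, undirected) graph with $|V|=n$ and $|E|=m$, and set \[ q := \left\lfloor \frac{\ln (n/2)}{\ln (2 e n^2/m)}\right\rfloor, \qquad r := \left\lfloor \frac{q n^2}{m}\right\rfloor. \] If $n$ is sufficiently large and $m \ge 3 n^{3/2}$, then Algorithm FIND-BIPARTITE (described in the context, run with these values of $q$ and $r$) returns a complete bipartite subgraph $K_{q,q}$ of $G$, and $q \ge 2$ as long as $m > 8 n^{3/2}$. The running time of the algorithm is polynomial in $n$.
   Context: Algorithm FIND-BIPARTITE: the input is a graph $G=(V,E)$ with $|V|=n$, $|E|=m$ (given, e.g., by its adjacency matrix), together with integers $q$ and $r$. Let $R$ be a set of $r$ vertices of $G$ of highest degree (i.e., every vertex in $R$ has degree at least that of every vertex outside $R$). For every subset $C\subseteq R$ with $|C|=q$, compute $D := \bigcap_{v\in C} (N(v)\setminus R)$, where $N(v)$ is the set of neighbours of $v$ in $G$; if $|D|\ge q$, let $D'$ be the first $q$ elements of $D$ and return $(C,D')$ (the pair $(C,D')$ spans a complete bipartite subgraph $K_{q,q}$ with parts $C$ and $D'$, i.e., every vertex of $C$ is adjacent to every vertex of $D'$). A $K_{q,q}$ means a complete bipartite graph with both parts of size $q$. -}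

module Defs where

open import Data.Nat using (ℕ; zero; suc; _+_; _*_; _^_; _≤_; _<_; _<ᵇ_; _!)
open import Data.Nat.Combinatorics using (_C_)
open import Data.Bool using (Bool; true; false; if_then_else_; _∧_)
open import Data.Fin using (Fin; toℕ)
import Data.Fin as Fin
open import Data.Fin.Subset using (Subset; _∈_; _∉_; _⊆_; ∣_∣)
open import Data.Product using (Σ; _×_; ∃; ∃-syntax)
open import Relation.Binary.PropositionalEquality using (_≡_)
open import Relation.Nullary using (¬_)

record Graph (n : ℕ) : Set where
  field
    adj    : Fin n → Fin n → Bool
    sym    : ∀ i j → adj i j ≡ adj j i
    irrefl : ∀ i → adj i i ≡ false
open Graph public

sumF : (n : ℕ) → (Fin n → ℕ) → ℕ
sumF zero    f = 0
sumF (suc n) f = f Fin.zero + sumF n (λ i → f (Fin.suc i))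

countF : (n : ℕ) → (Fin n → Bool) → ℕ
countF n p = sumF n (λ i → if p i then 1 else 0)

degree : ∀ {n} → Graph n → Fin n → ℕ
degree {n} G v = countF n (adj G v)

edgeCount : ∀ {n} → Graph n → ℕ
edgeCount {n} G = sumF n (λ i → countF n (λ j → (toℕ i <ᵇ toℕ j) ∧ adj G i j))

-- The exponential e^k at natural k, compared with a rational a/b.
-- T k N = N! * Σ_{j=0}^{N} k^j / j!  (a natural number), so the N-th
-- partial sum of the series e^k = Σ_j k^j/j! is T k N / N!.

T : ℕ → ℕ → ℕ
T k zero    = 1
T k (suc N) = suc N * T k N + k ^ suc N

-- "e^k ≤ a / b": every partial sum of the (strictly increasing,
-- convergent) series for e^k is ≤ a/b, i.e. its supremum e^k is ≤ a/b.
ExpLe : ℕ → ℕ → ℕ → Set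
ExpLe k a b = ∀ N → b * T k N ≤ a * (N !)

-- q = ⌊ ln(n/2) / ln(2 e n² / m) ⌋.
-- Since 2 e n² / m > 1 and n/2 ≥ 1, for a natural q this is equivalent to
--   (2 e n²/m)^q ≤ n/2 < (2 e n²/m)^(q+1),
-- i.e.  e^q ≤ n m^q / (2 (2 n²)^q)  and  not e^(q+1) ≤ n m^(q+1) / (2 (2 n²)^(q+1)).

IsQ : ℕ → ℕ → ℕ → Set
IsQ n m q =
  ExpLe q (n * m ^ q) (2 * (2 * (n * n)) ^ q) ×
  ¬ ExpLe (suc q) (n * m ^ suc q) (2 * (2 * (n * n)) ^ suc q)

IsR : ℕ → ℕ → ℕ → ℕ → Set
IsR n m q r = r * m ≤ q * (n * n) × q * (n * n) < suc r * m

IsTopDegreeSet : ∀ {n} → Graph n → ℕ → Subset n → Set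
IsTopDegreeSet G r R =
  ∣ R ∣ ≡ r × (∀ u v → u ∈ R → v ∉ R → degree G v ≤ degree G u)

-- Outcome of FIND-BIPARTITE: it returns a pair (C, D') with C ⊆ R, |C| = q,
-- D' ⊆ ⋂_{v∈C} (N(v) ∖ R), |D'| = q.  Such a pair exists iff some
-- q-subset C of R has |D| ≥ q, i.e. iff the algorithm does not fail;
-- every returned pair spans a K_{q,q}.
FindBipartiteReturns : ∀ {n} → Graph n → ℕ → Subset n → Set
FindBipartiteReturns {n} G q R =
  ∃[ C ] ∃[ D′ ]
    (C ⊆ R × ∣ C ∣ ≡ q × ∣ D′ ∣ ≡ q ×
     (∀ v → v ∈ D′ → v ∉ R) ×
     (∀ u v → u ∈ C → v ∈ D′ → adj G u v ≡ true))

-- Worst-case number of elementary steps of FIND-BIPARTITE on an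
-- adjacency matrix (unit-cost RAM):
--   n² to compute all degrees, n² to select R (e.g. selection by
--   repeated maxima), and for each of the (r choose q) subsets C ⊆ R of size q,
--   q·n steps to compute D by intersecting neighbourhood rows, plus n to
--   check |D| ≥ q and extract D'.
findBipartiteCost : ℕ → ℕ → ℕ → ℕ
findBipartiteCost n r q = n * n + n * n + (r C q) * (q * n + n)

module Submission where

-- FIND-BIPARTITE fails only if every q-subset C of the top-degree set R
-- has fewer than q common neighbours outside R.  We refute this by double
-- counting "q-stars", the pairs (C , v) with v ∉ R, C ⊆ N(v) ∩ R and
-- |C| = q: by centre they number Σ_{v∉R} C(x_v , q) with x_v = |N(v) ∩ R|,
-- by leaf set they number Σ_C |D_C|.  Once this exceeds (q-1)·C(r , q),
-- i.e. q-1 times the number of candidates C, the pigeonhole principle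
-- yields a C with |D_C| ≥ q, and hence a K_{q,q}.
--
-- From the
-- definitions of q and r (through q^q ≤ q!·e^q and C(r,q)·q! ≤ r^q) we get
-- C(r,q)·2^(q+1) ≤ n and 8r² ≤ (7q+1)n, which close the count.

open import Defs hiding (sym)
open import Data.Nat
  using (ℕ; zero; suc; _+_; _*_; _^_; _≤_; _<_; _≤?_; _<?_; z≤n; s≤s; _<ᵇ_; _≡ᵇ_; _!; NonZero; >-nonZero; ≢-nonZero⁻¹; s≤s⁻¹)
open import Data.Nat.Properties
import Data.Nat.Combinatorics as Comb
open import Data.Nat.Tactic.RingSolver using (solve-∀)
open import Data.Bool using (Bool; true; false; not; _∧_; if_then_else_) renaming (T to IsTrue)
open import Data.Fin using (Fin; toℕ)
import Data.Fin as Fin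
open import Data.Vec using ([]; _∷_; lookup; here; there)
open import Data.Vec.Properties using (lookup⇒[]=; []=⇒lookup)
open import Data.Fin.Subset using (Subset; _∈_; _∉_; _⊆_; ∣_∣; ⊥)
open import Data.Fin.Subset.Properties using (∉⊥; ∣⊥∣≡0)
open import Data.Product using (_×_; _,_; ∃-syntax)
open import Data.Empty using (⊥-elim)
open import Relation.Binary.PropositionalEquality
  using (_≡_; refl; sym; trans; cong; cong₂; subst; subst₂; module ≡-Reasoning)
open import Relation.Nullary using (¬_; yes; no)
open import Data.Bool.Properties using (∧-zeroʳ)

𝟙 : Bool → ℕ
𝟙 b = if b then 1 else 0

𝟙≤1 : ∀ b → 𝟙 b ≤ 1
𝟙≤1 true  = ≤-refl
𝟙≤1 false = z≤n

sumF-cong : ∀ n {f g : Fin n → ℕ} → (∀ i → f i ≡ g i) → sumF n f ≡ sumF n g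
sumF-cong zero    f≡g = refl
sumF-cong (suc n) f≡g = cong₂ _+_ (f≡g Fin.zero) (sumF-cong n (λ i → f≡g (Fin.suc i)))

sumF-mono : ∀ n {f g : Fin n → ℕ} → (∀ i → f i ≤ g i) → sumF n f ≤ sumF n g
sumF-mono zero    f≤g = z≤n
sumF-mono (suc n) f≤g = +-mono-≤ (f≤g Fin.zero) (sumF-mono n (λ i → f≤g (Fin.suc i)))

sumF-+ : ∀ n (f g : Fin n → ℕ) → sumF n (λ i → f i + g i) ≡ sumF n f + sumF n g
sumF-+ zero    f g = refl
sumF-+ (suc n) f g =
  trans (cong (f Fin.zero + g Fin.zero +_) (sumF-+ n (λ i → f (Fin.suc i)) (λ i → g (Fin.suc i))))
        (interchange (f Fin.zero) (g Fin.zero) _ _)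
  where
  interchange : ∀ a b c d → a + b + (c + d) ≡ a + c + (b + d)
  interchange = solve-∀

sumF-*ˡ : ∀ n c (f : Fin n → ℕ) → sumF n (λ i → c * f i) ≡ c * sumF n f
sumF-*ˡ zero    c f = sym (*-zeroʳ c)
sumF-*ˡ (suc n) c f =
  trans (cong (c * f Fin.zero +_) (sumF-*ˡ n c (λ i → f (Fin.suc i))))
        (sym (*-distribˡ-+ c (f Fin.zero) _))

sumF-*ʳ : ∀ n c (f : Fin n → ℕ) → sumF n (λ i → f i * c) ≡ sumF n f * c
sumF-*ʳ n c f = trans (sumF-cong n (λ i → *-comm (f i) c)) (trans (sumF-*ˡ n c f) (*-comm c _))

sumF-const : ∀ n c → sumF n (λ _ → c) ≡ n * c
sumF-const zero    c = refl
sumF-const (suc n) c = cong (c +_) (sumF-const n c)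

sumF-swap : ∀ n k (f : Fin n → Fin k → ℕ) →
  sumF n (λ i → sumF k (λ j → f i j)) ≡ sumF k (λ j → sumF n (λ i → f i j))
sumF-swap zero    k f = sym (trans (sumF-const k 0) (*-zeroʳ k))
sumF-swap (suc n) k f =
  trans (cong (sumF k (f Fin.zero) +_) (sumF-swap n k (λ i → f (Fin.suc i))))
        (sym (sumF-+ k (f Fin.zero) (λ j → sumF n (λ i → f (Fin.suc i) j))))

countF≤ : ∀ n (p : Fin n → Bool) → countF n p ≤ n
countF≤ zero    p = z≤n
countF≤ (suc n) p = +-mono-≤ (𝟙≤1 (p Fin.zero)) (countF≤ n (λ i → p (Fin.suc i)))

∣S∣≡countF : ∀ {n} (S : Subset n) → ∣ S ∣ ≡ countF n (lookup S)
∣S∣≡countF []          = refl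
∣S∣≡countF (true ∷ S)  = cong suc (∣S∣≡countF S)
∣S∣≡countF (false ∷ S) = ∣S∣≡countF S

-- Binomial coefficients by Pascal's rule; they agree with the library's _C_,
-- but the recursion is what the counting arguments below induct on.

choose : ℕ → ℕ → ℕ
choose n       zero    = 1
choose zero    (suc k) = 0
choose (suc n) (suc k) = choose n k + choose n (suc k)

choose≡C : ∀ n k → choose n k ≡ n Comb.C k
choose≡C n       zero    = refl
choose≡C zero    (suc k) = refl
choose≡C (suc n) (suc k) =
  trans (cong₂ _+_ (choose≡C n k) (choose≡C n (suc k))) (Comb.nCk+nC[k+1]≡[n+1]C[k+1] n k)

choose-pos : ∀ x p → p ≤ x → 1 ≤ choose x p
choose-pos x       zero    _   = ≤-refl
choose-pos (suc x) (suc p) p≤x = ≤-trans (choose-pos x p (s≤s⁻¹ p≤x)) (m≤m+n _ _)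

-- x ≤ C(x , p+1) + p : a set of x ≥ p+1 elements has at least x - p
-- subsets of size p+1.  This linearises  C(x_v , q)  in x_v.
choose-linear : ∀ x p → x ≤ choose x (suc p) + p
choose-linear zero    p = z≤n
choose-linear (suc x) p with p ≤? x
... | no  p≰x = ≤-trans (≰⇒> p≰x) (m≤n+m p _)
... | yes p≤x = begin
    suc x                                  ≤⟨ s≤s (choose-linear x p) ⟩
    suc (choose x (suc p) + p)             ≤⟨ +-monoˡ-≤ _ (choose-pos x p p≤x) ⟩
    choose x p + (choose x (suc p) + p)    ≡⟨ sym (+-assoc (choose x p) _ p) ⟩
    choose x p + choose x (suc p) + p      ∎
  where open ≤-Reasoning

bernoulli : ∀ r q → r ^ suc q + suc q * r ^ q ≤ suc r ^ suc q
bernoulli r zero = ≤-reflexive (base r)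
  where
  base : ∀ r → r * 1 + 1 * 1 ≡ (1 + r) * 1
  base = solve-∀
bernoulli r (suc q) = begin
    r ^ suc (suc q) + suc (suc q) * r ^ suc q
  ≡⟨ regroup r (r ^ q) q ⟩
    r * (r ^ suc q + suc q * r ^ q) + r ^ suc q
  ≤⟨ +-monoʳ-≤ (r * _) (m≤m+n (r ^ suc q) (suc q * r ^ q)) ⟩
    r * (r ^ suc q + suc q * r ^ q) + (r ^ suc q + suc q * r ^ q)
  ≤⟨ +-mono-≤ (*-monoʳ-≤ r (bernoulli r q)) (bernoulli r q) ⟩
    r * suc r ^ suc q + suc r ^ suc q
  ≡⟨ +-comm (r * suc r ^ suc q) _ ⟩
    suc r ^ suc (suc q)
  ∎
  where
  open ≤-Reasoning
  regroup : ∀ r x q → r * (r * x) + (2 + q) * (r * x) ≡ r * (r * x + (1 + q) * x) + r * x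
  regroup = solve-∀

-- C(r , q)·q! ≤ r^q: injective q-tuples are among all q-tuples.
choose*!≤^ : ∀ r q → choose r q * q ! ≤ r ^ q
choose*!≤^ r       zero    = ≤-refl
choose*!≤^ zero    (suc q) = z≤n
choose*!≤^ (suc r) (suc q) = begin
    (choose r q + choose r (suc q)) * (suc q * q !)
  ≡⟨ regroup (choose r q) (choose r (suc q)) q (q !) ⟩
    choose r (suc q) * (suc q * q !) + suc q * (choose r q * q !)
  ≤⟨ +-mono-≤ (choose*!≤^ r (suc q)) (*-monoʳ-≤ (suc q) (choose*!≤^ r q)) ⟩
    r ^ suc q + suc q * r ^ q
  ≤⟨ bernoulli r q ⟩
    suc r ^ suc q
  ∎
  where
  open ≤-Reasoning
  regroup : ∀ a b q f → (a + b) * ((1 + q) * f) ≡ b * ((1 + q) * f) + (1 + q) * (a * f)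
  regroup = solve-∀

sumSubsets : (n : ℕ) → (Subset n → ℕ) → ℕ
sumSubsets zero    F = F []
sumSubsets (suc n) F = sumSubsets n (λ C → F (false ∷ C)) + sumSubsets n (λ C → F (true ∷ C))

sumSubsets-cong : ∀ n {F G : Subset n → ℕ} → (∀ C → F C ≡ G C) → sumSubsets n F ≡ sumSubsets n G
sumSubsets-cong zero    F≡G = F≡G []
sumSubsets-cong (suc n) F≡G =
  cong₂ _+_ (sumSubsets-cong n (λ C → F≡G (false ∷ C))) (sumSubsets-cong n (λ C → F≡G (true ∷ C)))

sumSubsets-swap : ∀ n k (F : Subset n → Fin k → ℕ) →
  sumSubsets n (λ C → sumF k (F C)) ≡ sumF k (λ v → sumSubsets n (λ C → F C v))
sumSubsets-swap zero    k F = refl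
sumSubsets-swap (suc n) k F =
  trans (cong₂ _+_ (sumSubsets-swap n k (λ C → F (false ∷ C))) (sumSubsets-swap n k (λ C → F (true ∷ C))))
        (sym (sumF-+ k _ _))

sumSubsets-*ˡ : ∀ n c (F : Subset n → ℕ) → sumSubsets n (λ C → c * F C) ≡ c * sumSubsets n F
sumSubsets-*ˡ zero    c F = refl
sumSubsets-*ˡ (suc n) c F =
  trans (cong₂ _+_ (sumSubsets-*ˡ n c (λ C → F (false ∷ C))) (sumSubsets-*ˡ n c (λ C → F (true ∷ C))))
        (sym (*-distribˡ-+ c _ _))

sumSubsets-zero : ∀ n → sumSubsets n (λ _ → 0) ≡ 0
sumSubsets-zero zero    = refl
sumSubsets-zero (suc n) = cong₂ _+_ (sumSubsets-zero n) (sumSubsets-zero n)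

allIn : ∀ {n} → Subset n → (Fin n → Bool) → Bool
allIn []      f = true
allIn (b ∷ C) f = (if b then f Fin.zero else true) ∧ allIn C (λ i → f (Fin.suc i))

∧-interchange : ∀ a b c d → (a ∧ b) ∧ (c ∧ d) ≡ (a ∧ c) ∧ (b ∧ d)
∧-interchange false b c     d = refl
∧-interchange true  b false d with b
... | true  = refl
... | false = refl
∧-interchange true  b true  d = refl

∧-true⇒ˡ : ∀ {a b} → a ∧ b ≡ true → a ≡ true
∧-true⇒ˡ {true} _ = refl

∧-true⇒ʳ : ∀ {a b} → a ∧ b ≡ true → b ≡ true
∧-true⇒ʳ {true} ab = ab

allIn-∧ : ∀ {n} (C : Subset n) (f g : Fin n → Bool) →
  allIn C (λ u → f u ∧ g u) ≡ allIn C f ∧ allIn C g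
allIn-∧ []          f g = refl
allIn-∧ (true ∷ C)  f g =
  trans (cong ((f Fin.zero ∧ g Fin.zero) ∧_) (allIn-∧ C (λ i → f (Fin.suc i)) (λ i → g (Fin.suc i))))
        (∧-interchange (f Fin.zero) (g Fin.zero) _ _)
allIn-∧ (false ∷ C) f g = allIn-∧ C (λ i → f (Fin.suc i)) (λ i → g (Fin.suc i))

allIn-∈ : ∀ {n} (C : Subset n) (f : Fin n → Bool) x → allIn C f ≡ true → x ∈ C → f x ≡ true
allIn-∈ (true ∷ C) f Fin.zero    all here      = ∧-true⇒ˡ all
allIn-∈ (b ∷ C)    f (Fin.suc x) all (there x∈C) =
  allIn-∈ C (λ i → f (Fin.suc i)) x (∧-true⇒ʳ {if b then f Fin.zero else true} all) x∈C

countSubsets : ∀ n (f : Fin n → Bool) q →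
  sumSubsets n (λ C → 𝟙 (allIn C f ∧ (∣ C ∣ ≡ᵇ q))) ≡ choose (countF n f) q
countSubsets zero    f zero    = refl
countSubsets zero    f (suc q) = refl
countSubsets (suc n) f q with f Fin.zero
... | false =
  trans (cong₂ _+_ (countSubsets n (λ i → f (Fin.suc i)) q) (sumSubsets-zero n)) (+-identityʳ _)
countSubsets (suc n) f zero | true =
  cong₂ _+_ (countSubsets n (λ i → f (Fin.suc i)) zero)
            (trans (sumSubsets-cong n (λ C → cong 𝟙 (∧-zeroʳ _))) (sumSubsets-zero n))
countSubsets (suc n) f (suc q) | true =
  trans (cong₂ _+_ (countSubsets n (λ i → f (Fin.suc i)) (suc q)) (countSubsets n (λ i → f (Fin.suc i)) q))
        (+-comm (choose (countF n (λ i → f (Fin.suc i))) (suc q)) _)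

split-< : ∀ a₁ a₂ s₁ s₂ → a₁ + a₂ < s₁ + s₂ → s₁ ≤ a₁ → a₂ < s₂
split-< a₁ a₂ s₁ s₂ lt s₁≤a₁ with a₂ <? s₂
... | yes a₂<s₂ = a₂<s₂
... | no  a₂≮s₂ = ⊥-elim (<-irrefl refl (<-≤-trans lt (+-mono-≤ s₁≤a₁ (≮⇒≥ a₂≮s₂))))

pigeonhole : ∀ n k (P : Subset n → Bool) (g : Subset n → ℕ) →
  k * sumSubsets n (λ C → 𝟙 (P C)) < sumSubsets n (λ C → 𝟙 (P C) * g C) →
  ∃[ C ] (P C ≡ true × k < g C)
pigeonhole zero k P g lt with P [] in P[]
... | true  = [] , P[] , subst₂ _<_ (*-identityʳ k) (+-identityʳ (g [])) lt
... | false = ⊥-elim (n≮0 lt)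
pigeonhole (suc n) k P g lt
  with k * sumSubsets n (λ C → 𝟙 (P (false ∷ C))) <? sumSubsets n (λ C → 𝟙 (P (false ∷ C)) * g (false ∷ C))
... | yes lt₀ =
  let (C , PC , k<gC) = pigeonhole n k (λ C → P (false ∷ C)) (λ C → g (false ∷ C)) lt₀
  in (false ∷ C) , PC , k<gC
... | no ¬lt₀ =
  let (C , PC , k<gC) = pigeonhole n k (λ C → P (true ∷ C)) (λ C → g (true ∷ C)) lt₁
  in (true ∷ C) , PC , k<gC
  where
  lt₁ : k * sumSubsets n (λ C → 𝟙 (P (true ∷ C))) < sumSubsets n (λ C → 𝟙 (P (true ∷ C)) * g (true ∷ C))
  lt₁ = split-< (k * sumSubsets n (λ C → 𝟙 (P (false ∷ C)))) _ _ _
          (subst (_< sumSubsets (suc n) (λ C → 𝟙 (P C) * g C)) (*-distribˡ-+ k _ _) lt) (≮⇒≥ ¬lt₀)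

subsetOfSize : ∀ n (h : Fin n → Bool) q → q ≤ countF n h →
  ∃[ D ] (∣ D ∣ ≡ q × (∀ v → v ∈ D → h v ≡ true))
subsetOfSize n       h zero    _ = ⊥ , ∣⊥∣≡0 n , λ v v∈⊥ → ⊥-elim (∉⊥ v∈⊥)
subsetOfSize (suc n) h (suc q) q<count with h Fin.zero in h0
... | true =
  let (D , ∣D∣ , D⊆h) = subsetOfSize n (λ i → h (Fin.suc i)) q (s≤s⁻¹ q<count)
  in (true ∷ D) , cong suc ∣D∣ , λ { Fin.zero here → h0 ; (Fin.suc v) (there v∈D) → D⊆h v v∈D }
... | false =
  let (D , ∣D∣ , D⊆h) = subsetOfSize n (λ i → h (Fin.suc i)) (suc q) q<count
  in (false ∷ D) , ∣D∣ , λ { (Fin.suc v) (there v∈D) → D⊆h v v∈D }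

module _ {n : ℕ} (G : Graph n) where

  orientedEdge : Fin n → Fin n → ℕ
  orientedEdge i j = 𝟙 ((toℕ i <ᵇ toℕ j) ∧ adj G i j)

  orientations≤edge : ∀ i j → orientedEdge i j + orientedEdge j i ≤ 𝟙 (adj G i j)
  orientations≤edge i j rewrite Graph.sym G j i
    with toℕ i <ᵇ toℕ j in i<j | toℕ j <ᵇ toℕ i in j<i | adj G i j
  ... | true  | true  | _     = ⊥-elim (<-asym (<ᵇ⇒< (toℕ i) (toℕ j) (subst IsTrue (sym i<j) _))
                                              (<ᵇ⇒< (toℕ j) (toℕ i) (subst IsTrue (sym j<i) _)))
  ... | true  | false | true  = ≤-refl
  ... | true  | false | false = ≤-refl
  ... | false | true  | true  = ≤-refl
  ... | false | true  | false = ≤-refl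
  ... | false | false | true  = z≤n
  ... | false | false | false = ≤-refl

  handshake : 2 * edgeCount G ≤ sumF n (degree G)
  handshake = begin
      2 * edgeCount G
    ≡⟨ cong (edgeCount G +_) (+-identityʳ _) ⟩
      edgeCount G + edgeCount G
    ≡⟨ cong (edgeCount G +_) (sumF-swap n n orientedEdge) ⟩
      sumF n (λ i → sumF n (orientedEdge i)) + sumF n (λ i → sumF n (λ j → orientedEdge j i))
    ≡⟨ sym (sumF-+ n _ _) ⟩
      sumF n (λ i → sumF n (orientedEdge i) + sumF n (λ j → orientedEdge j i))
    ≡⟨ sumF-cong n (λ i → sym (sumF-+ n _ _)) ⟩
      sumF n (λ i → sumF n (λ j → orientedEdge i j + orientedEdge j i))
    ≤⟨ sumF-mono n (λ i → sumF-mono n (orientations≤edge i)) ⟩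
      sumF n (degree G)
    ∎
    where open ≤-Reasoning

  degreeSum≤ : sumF n (degree G) ≤ n * n
  degreeSum≤ = ≤-trans (sumF-mono n (λ i → countF≤ n (adj G i))) (≤-reflexive (sumF-const n n))

  edgeCount≤n² : edgeCount G ≤ n * n
  edgeCount≤n² = ≤-trans (m≤m+n (edgeCount G) (edgeCount G + 0)) (≤-trans handshake degreeSum≤)

module _ {n : ℕ} (R : Subset n) where

  inside outside : Fin n → ℕ
  inside  u = 𝟙 (lookup R u)
  outside u = 𝟙 (not (lookup R u))

  inside+outside≡1 : ∀ u → inside u + outside u ≡ 1
  inside+outside≡1 u with lookup R u
  ... | true  = refl
  ... | false = refl

  weightIn weightOut : (Fin n → ℕ) → ℕ
  weightIn  d = sumF n (λ u → inside u * d u)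
  weightOut d = sumF n (λ u → outside u * d u)

  weight-split : ∀ d → sumF n d ≡ weightIn d + weightOut d
  weight-split d = trans (sumF-cong n split) (sumF-+ n _ _)
    where
    split : ∀ u → d u ≡ inside u * d u + outside u * d u
    split u = trans (sym (*-identityˡ (d u)))
                    (trans (cong (_* d u) (sym (inside+outside≡1 u))) (*-distribʳ-+ (d u) (inside u) (outside u)))

  ∣R∣+∣∁R∣≡n : ∣ R ∣ + sumF n outside ≡ n
  ∣R∣+∣∁R∣≡n = trans (cong (_+ sumF n outside) (∣S∣≡countF R))
    (trans (sym (sumF-+ n inside outside))
           (trans (sumF-cong n inside+outside≡1) (trans (sumF-const n 1) (*-identityʳ n))))

  topAverage : (d : Fin n → ℕ) → (∀ u v → u ∈ R → v ∉ R → d v ≤ d u) →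
    ∣ R ∣ * sumF n d ≤ n * weightIn d
  topAverage d dominates = begin
      ∣ R ∣ * sumF n d
    ≡⟨ cong (∣ R ∣ *_) (weight-split d) ⟩
      ∣ R ∣ * (weightIn d + weightOut d)
    ≡⟨ *-distribˡ-+ ∣ R ∣ (weightIn d) (weightOut d) ⟩
      ∣ R ∣ * weightIn d + ∣ R ∣ * weightOut d
    ≤⟨ +-monoʳ-≤ (∣ R ∣ * weightIn d) (subst (λ s → s * weightOut d ≤ sumF n outside * weightIn d) (sym (∣S∣≡countF R)) exchange) ⟩
      ∣ R ∣ * weightIn d + sumF n outside * weightIn d
    ≡⟨ sym (*-distribʳ-+ (weightIn d) ∣ R ∣ (sumF n outside)) ⟩
      (∣ R ∣ + sumF n outside) * weightIn d
    ≡⟨ cong (_* weightIn d) ∣R∣+∣∁R∣≡n ⟩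
      n * weightIn d
    ∎
    where
    open ≤-Reasoning
    pointwise : ∀ u v → inside u * (outside v * d v) ≤ outside v * (inside u * d u)
    pointwise u v with lookup R u in Ru | lookup R v in Rv
    ... | false | _     = z≤n
    ... | true  | true  = z≤n
    ... | true  | false = +-monoˡ-≤ 0 (+-monoˡ-≤ 0
          (dominates u v (lookup⇒[]= u R Ru) (λ v∈R → true≢false (trans (sym ([]=⇒lookup v∈R)) Rv))))
      where
      true≢false : true ≡ false → Data.Empty.⊥
      true≢false ()
    exchange : sumF n inside * weightOut d ≤ sumF n outside * weightIn d
    exchange = begin
        sumF n inside * weightOut d
      ≡⟨ sym (sumF-*ʳ n _ inside) ⟩
        sumF n (λ u → inside u * weightOut d)
      ≡⟨ sumF-cong n (λ u → sym (sumF-*ˡ n (inside u) _)) ⟩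
        sumF n (λ u → sumF n (λ v → inside u * (outside v * d v)))
      ≤⟨ sumF-mono n (λ u → sumF-mono n (pointwise u)) ⟩
        sumF n (λ u → sumF n (λ v → outside v * (inside u * d u)))
      ≡⟨ sumF-cong n (λ u → sumF-*ʳ n _ outside) ⟩
        sumF n (λ u → sumF n outside * (inside u * d u))
      ≡⟨ sumF-*ˡ n (sumF n outside) _ ⟩
        sumF n outside * weightIn d
      ∎

module _ {n : ℕ} (G : Graph n) (R : Subset n) where

  neighboursInR : Fin n → ℕ
  neighboursInR v = countF n (λ u → adj G v u ∧ lookup R u)

  crossEdges : ℕ
  crossEdges = weightOut R neighboursInR

  -- Every edge at a vertex of R either stays inside R or comes from outside R.
  degreeInR≤ : weightIn R (degree G) ≤ crossEdges + ∣ R ∣ * ∣ R ∣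
  degreeInR≤ = begin
      weightIn R (degree G)
    ≡⟨ sumF-cong n (λ u → sym (sumF-*ˡ n (inside R u) _)) ⟩
      sumF n (λ u → sumF n (λ v → inside R u * 𝟙 (adj G u v)))
    ≤⟨ sumF-mono n (λ u → sumF-mono n (pointwise u)) ⟩
      sumF n (λ u → sumF n (λ v → inside R u * inside R v + outside R v * 𝟙 (adj G v u ∧ lookup R u)))
    ≡⟨ sumF-cong n (λ u → sumF-+ n _ _) ⟩
      sumF n (λ u → sumF n (λ v → inside R u * inside R v) + sumF n (λ v → outside R v * 𝟙 (adj G v u ∧ lookup R u)))
    ≡⟨ sumF-+ n _ _ ⟩
      sumF n (λ u → sumF n (λ v → inside R u * inside R v)) + sumF n (λ u → sumF n (λ v → outside R v * 𝟙 (adj G v u ∧ lookup R u)))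
    ≡⟨ cong₂ _+_ (trans (sumF-cong n (λ u → sumF-*ˡ n (inside R u) (inside R))) (sumF-*ʳ n _ (inside R)))
                 (sumF-swap n n _) ⟩
      ∣R∣′ * ∣R∣′ + sumF n (λ v → sumF n (λ u → outside R v * 𝟙 (adj G v u ∧ lookup R u)))
    ≡⟨ cong (∣R∣′ * ∣R∣′ +_) (sumF-cong n (λ v → sumF-*ˡ n (outside R v) _)) ⟩
      ∣R∣′ * ∣R∣′ + crossEdges
    ≡⟨ +-comm _ crossEdges ⟩
      crossEdges + ∣R∣′ * ∣R∣′
    ≡⟨ cong (λ s → crossEdges + s * s) (sym (∣S∣≡countF R)) ⟩
      crossEdges + ∣ R ∣ * ∣ R ∣
    ∎
    where
    open ≤-Reasoning
    ∣R∣′ : ℕ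
    ∣R∣′ = countF n (lookup R)
    pointwise : ∀ u v →
      inside R u * 𝟙 (adj G u v) ≤ inside R u * inside R v + outside R v * 𝟙 (adj G v u ∧ lookup R u)
    pointwise u v rewrite Graph.sym G v u with lookup R u | lookup R v | adj G u v
    ... | false | _     | _     = z≤n
    ... | true  | true  | true  = ≤-refl
    ... | true  | true  | false = z≤n
    ... | true  | false | true  = ≤-refl
    ... | true  | false | false = z≤n

  -- Σ_{v∉R} C(x_v , q): pairs (C , v) with v ∉ R and C a q-subset of N(v) ∩ R
  stars : ℕ → ℕ
  stars q = weightOut R (λ v → choose (neighboursInR v) q)

  crossEdges≤stars : ∀ p → crossEdges ≤ stars (suc p) + n * p
  crossEdges≤stars p =
    ≤-trans (sumF-mono n pointwise) (≤-reflexive (trans (sumF-+ n _ _) (cong (stars (suc p) +_) (sumF-const n p))))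
    where
    pointwise : ∀ v → outside R v * neighboursInR v ≤ outside R v * choose (neighboursInR v) (suc p) + p
    pointwise v with lookup R v
    ... | true  = z≤n
    ... | false = subst₂ _≤_ (sym (+-identityʳ _)) (cong (_+ p) (sym (+-identityʳ _))) (choose-linear (neighboursInR v) p)

  isCandidate : ℕ → Subset n → Bool
  isCandidate q C = allIn C (lookup R) ∧ (∣ C ∣ ≡ᵇ q)

  commonOutsideR : Subset n → Fin n → Bool
  commonOutsideR C v = not (lookup R v) ∧ allIn C (adj G v)

  commonOutside : Subset n → ℕ
  commonOutside C = countF n (commonOutsideR C)

  candidates : ∀ q → sumSubsets n (λ C → 𝟙 (isCandidate q C)) ≡ choose ∣ R ∣ q
  candidates q = trans (countSubsets n (lookup R) q) (cong (λ s → choose s q) (sym (∣S∣≡countF R)))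

  -- Double counting the q-stars, once by centre v and once by leaf set C.
  doubleCount : ∀ q → stars q ≡ sumSubsets n (λ C → 𝟙 (isCandidate q C) * commonOutside C)
  doubleCount q = begin
      stars q
    ≡⟨ sumF-cong n (λ v → cong (outside R v *_) (sym (countSubsets n (λ u → adj G v u ∧ lookup R u) q))) ⟩
      sumF n (λ v → outside R v * sumSubsets n (λ C → 𝟙 (starAt v C)))
    ≡⟨ sumF-cong n (λ v → sym (sumSubsets-*ˡ n (outside R v) _)) ⟩
      sumF n (λ v → sumSubsets n (λ C → outside R v * 𝟙 (starAt v C)))
    ≡⟨ sym (sumSubsets-swap n n _) ⟩
      sumSubsets n (λ C → sumF n (λ v → outside R v * 𝟙 (starAt v C)))
    ≡⟨ sumSubsets-cong n (λ C → trans (sumF-cong n (regroup C)) (sumF-*ˡ n (𝟙 (isCandidate q C)) _)) ⟩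
      sumSubsets n (λ C → 𝟙 (isCandidate q C) * commonOutside C)
    ∎
    where
    open ≡-Reasoning
    starAt : Fin n → Subset n → Bool
    starAt v C = allIn C (λ u → adj G v u ∧ lookup R u) ∧ (∣ C ∣ ≡ᵇ q)
    swapIndicators : ∀ a s t e → 𝟙 (not a) * 𝟙 ((s ∧ t) ∧ e) ≡ 𝟙 (t ∧ e) * 𝟙 (not a ∧ s)
    swapIndicators true  s     t     e     = sym (*-zeroʳ (𝟙 (t ∧ e)))
    swapIndicators false true  true  e     = *-comm 1 (𝟙 e)
    swapIndicators false true  false e     = refl
    swapIndicators false false true  true  = refl
    swapIndicators false false true  false = refl
    swapIndicators false false false e     = refl
    regroup : ∀ C v → outside R v * 𝟙 (starAt v C) ≡ 𝟙 (isCandidate q C) * 𝟙 (commonOutsideR C v)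
    regroup C v =
      trans (cong (λ b → outside R v * 𝟙 (b ∧ (∣ C ∣ ≡ᵇ q))) (allIn-∧ C (adj G v) (lookup R)))
            (swapIndicators (lookup R v) (allIn C (adj G v)) (allIn C (lookup R)) (∣ C ∣ ≡ᵇ q))

  fromCandidate : ∀ q C → isCandidate q C ≡ true → q ≤ commonOutside C → FindBipartiteReturns G q R
  fromCandidate q C cand enough with subsetOfSize n (commonOutsideR C) q enough
  ... | D′ , ∣D′∣≡q , D′⊆D = C , D′ , C⊆R , ∣C∣≡q , ∣D′∣≡q , D′∩R≡∅ , complete
    where
    C⊆R : C ⊆ R
    C⊆R {x} x∈C = lookup⇒[]= x R (allIn-∈ C (lookup R) x (∧-true⇒ˡ cand) x∈C)
    ∣C∣≡q : ∣ C ∣ ≡ q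
    ∣C∣≡q = ≡ᵇ⇒≡ ∣ C ∣ q (subst IsTrue (sym (∧-true⇒ʳ {allIn C (lookup R)} cand)) _)
    D′∩R≡∅ : ∀ v → v ∈ D′ → v ∉ R
    D′∩R≡∅ v v∈D′ v∈R = contradictory (∧-true⇒ˡ {not (lookup R v)} (D′⊆D v v∈D′)) ([]=⇒lookup v∈R)
      where
      contradictory : ∀ {b} → not b ≡ true → b ≡ true → Data.Empty.⊥
      contradictory {false} _ ()
    complete : ∀ u v → u ∈ C → v ∈ D′ → adj G u v ≡ true
    complete u v u∈C v∈D′ =
      trans (Graph.sym G u v) (allIn-∈ C (adj G v) u (∧-true⇒ʳ {not (lookup R v)} (D′⊆D v v∈D′)) u∈C)

  bipartite-from-stars : ∀ p → p * choose ∣ R ∣ (suc p) < stars (suc p) → FindBipartiteReturns G (suc p) R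
  bipartite-from-stars p many
    with pigeonhole n p (isCandidate (suc p)) commonOutside
           (subst₂ (λ a b → p * a < b) (sym (candidates (suc p))) (doubleCount (suc p)) many)
  ... | C , cand , p<∣D∣ = fromCandidate (suc p) C cand p<∣D∣

findBipartite-q0 : ∀ {n} (G : Graph n) (R : Subset n) → FindBipartiteReturns G 0 R
findBipartite-q0 {n} G R =
  ⊥ , ⊥ , (λ x∈⊥ → ⊥-elim (∉⊥ x∈⊥)) , ∣⊥∣≡0 n , ∣⊥∣≡0 n ,
  (λ v v∈⊥ → ⊥-elim (∉⊥ v∈⊥)) , (λ u v u∈⊥ → ⊥-elim (∉⊥ u∈⊥))

^-distrib-* : ∀ a b q → (a * b) ^ q ≡ a ^ q * b ^ q
^-distrib-* a b zero    = refl
^-distrib-* a b (suc q) = trans (cong (a * b *_) (^-distrib-* a b q)) (interchange a b (a ^ q) (b ^ q))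
  where
  interchange : ∀ a b x y → a * b * (x * y) ≡ a * x * (b * y)
  interchange = solve-∀

n<2^n : ∀ n → n < 2 ^ n
n<2^n zero    = s≤s z≤n
n<2^n (suc n) = begin
  2 + n              ≤⟨ s≤s (n<2^n n) ⟩
  1 + 2 ^ n          ≤⟨ +-monoˡ-≤ (2 ^ n) (m^n>0 2 n) ⟩
  2 ^ n + 2 ^ n      ≡⟨ cong (2 ^ n +_) (sym (+-identityʳ (2 ^ n))) ⟩
  2 ^ suc n          ∎
  where open ≤-Reasoning

-- The last term k^N/N! of the partial sum: k^N ≤ T k N.
^≤T : ∀ k N → k ^ N ≤ T k N
^≤T k zero    = ≤-refl
^≤T k (suc N) = m≤n+m (k ^ suc N) (suc N * T k N)

T-monoˡ : ∀ {k l} N → k ≤ l → T k N ≤ T l N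
T-monoˡ zero    k≤l = ≤-refl
T-monoˡ (suc N) k≤l = +-mono-≤ (*-monoʳ-≤ (suc N) (T-monoˡ N k≤l)) (^-monoˡ-≤ (suc N) k≤l)

-- e² ≤ 8: the invariant T 2 N + 2^N ≤ 8·N! holds from N = 3 on, since
-- each step multiplies the left side by at most N+1 once N+1 ≥ 4.
T2+2^≤8! : ∀ k → T 2 (3 + k) + 2 ^ (3 + k) ≤ 8 * (3 + k) !
T2+2^≤8! zero    = ≤ᵇ⇒≤ 46 48 _
T2+2^≤8! (suc k) = begin
    suc N * T 2 N + 2 ^ suc N + 2 ^ suc N
  ≡⟨ regroup N (T 2 N) (2 ^ N) ⟩
    suc N * T 2 N + 4 * 2 ^ N
  ≤⟨ +-monoʳ-≤ (suc N * T 2 N) (*-monoˡ-≤ (2 ^ N) 4≤1+N) ⟩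
    suc N * T 2 N + suc N * 2 ^ N
  ≡⟨ sym (*-distribˡ-+ (suc N) (T 2 N) (2 ^ N)) ⟩
    suc N * (T 2 N + 2 ^ N)
  ≤⟨ *-monoʳ-≤ (suc N) (T2+2^≤8! k) ⟩
    suc N * (8 * N !)
  ≡⟨ x∙yz≈y∙xz (suc N) 8 (N !) ⟩
    8 * (suc N * N !)
  ∎
  where
  N = 3 + k
  4≤1+N : 4 ≤ suc N
  4≤1+N = s≤s (s≤s (s≤s (s≤s z≤n)))
  open ≤-Reasoning
  open import Algebra.Properties.CommutativeSemigroup *-commutativeSemigroup using (x∙yz≈y∙xz)
  regroup : ∀ N t x → (1 + N) * t + 2 * x + 2 * x ≡ (1 + N) * t + 4 * x
  regroup = solve-∀

T2≤8! : ∀ N → T 2 N ≤ 8 * N !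
T2≤8! 0 = ≤ᵇ⇒≤ 1 8 _
T2≤8! 1 = ≤ᵇ⇒≤ 3 8 _
T2≤8! 2 = ≤ᵇ⇒≤ 10 16 _
T2≤8! (suc (suc (suc k))) = ≤-trans (m≤m+n _ _) (T2+2^≤8! k)

-- The N = 0 instance of  e^k ≤ a/b  is  b ≤ a.
expLe⇒≤ : ∀ {k a b} → ExpLe k a b → b ≤ a
expLe⇒≤ {k} {a} {b} e = subst₂ _≤_ (*-identityʳ b) (*-identityʳ a) (e 0)

-- C(r,q)·2^(q+1) ≤ n, because C(r,q) ≤ r^q/q! ≤ (qn²/m)^q/q! and
-- q^q/q! ≤ e^q.
choose-r-q-bound : ∀ n m q r .{{_ : NonZero n}} .{{_ : NonZero m}} → r * m ≤ q * (n * n) →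
  ExpLe q (n * m ^ q) (2 * (2 * (n * n)) ^ q) → choose r q * 2 ^ suc q ≤ n
choose-r-q-bound n m q r rm≤ expLe = *-cancelʳ-≤ (choose r q * 2 ^ suc q) n K {{K≢0}} (begin
    choose r q * 2 ^ suc q * K
  ≡⟨ regroup (choose r q) (q !) (m ^ q) (2 ^ q) (nn ^ q) ⟩
    choose r q * q ! * m ^ q * (2 * (2 ^ q * nn ^ q))
  ≤⟨ *-monoˡ-≤ (2 * (2 ^ q * nn ^ q)) (*-monoˡ-≤ (m ^ q) (choose*!≤^ r q)) ⟩
    r ^ q * m ^ q * (2 * (2 ^ q * nn ^ q))
  ≡⟨ cong₂ (λ a b → a * (2 * b)) (sym (^-distrib-* r m q)) (sym (^-distrib-* 2 nn q)) ⟩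
    (r * m) ^ q * (2 * (2 * nn) ^ q)
  ≤⟨ *-monoˡ-≤ (2 * (2 * nn) ^ q) (^-monoˡ-≤ q rm≤) ⟩
    (q * nn) ^ q * (2 * (2 * nn) ^ q)
  ≡⟨ trans (cong (_* (2 * (2 * nn) ^ q)) (^-distrib-* q nn q)) (rotate (q ^ q) (nn ^ q) _) ⟩
    nn ^ q * (2 * (2 * nn) ^ q * q ^ q)
  ≤⟨ *-monoʳ-≤ (nn ^ q) (*-monoʳ-≤ (2 * (2 * nn) ^ q) (^≤T q q)) ⟩
    nn ^ q * (2 * (2 * nn) ^ q * T q q)
  ≤⟨ *-monoʳ-≤ (nn ^ q) (expLe q) ⟩
    nn ^ q * (n * m ^ q * q !)
  ≡⟨ unfoldK (nn ^ q) n (m ^ q) (q !) ⟩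
    n * K
  ∎)
  where
  open ≤-Reasoning
  nn = n * n
  K = q ! * m ^ q * nn ^ q
  K≢0 : NonZero K
  K≢0 = m*n≢0 (q ! * m ^ q) (nn ^ q) {{m*n≢0 (q !) (m ^ q) {{q !≢0}} {{m^n≢0 m q}}}} {{m^n≢0 nn q {{m*n≢0 n n}}}}
  regroup : ∀ b f M P Q → b * (2 * P) * (f * M * Q) ≡ b * f * M * (2 * (P * Q))
  regroup = solve-∀
  rotate : ∀ a b c → a * b * c ≡ b * (c * a)
  rotate = solve-∀
  unfoldK : ∀ Q n M f → Q * (n * M * f) ≡ n * (f * M * Q)
  unfoldK = solve-∀

-- q < 2^(q+1) ≤ n, since 2(2n²)^q ≤ n·m^q ≤ n·(n²)^q when m ≤ n².
q≤n : ∀ n m q .{{_ : NonZero n}} → m ≤ n * n → 2 * (2 * (n * n)) ^ q ≤ n * m ^ q → q ≤ n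
q≤n n m q m≤nn powerBound =
  ≤-trans (<⇒≤ (n<2^n q)) (≤-trans (m≤n*m (2 ^ q) 2) (*-cancelʳ-≤ _ _ (nn ^ q) {{m^n≢0 nn q {{m*n≢0 n n}}}} (begin
    2 * 2 ^ q * nn ^ q              ≡⟨ *-assoc 2 (2 ^ q) (nn ^ q) ⟩
    2 * (2 ^ q * nn ^ q)            ≡⟨ cong (2 *_) (sym (^-distrib-* 2 nn q)) ⟩
    2 * (2 * nn) ^ q                ≤⟨ powerBound ⟩
    n * m ^ q                       ≤⟨ *-monoʳ-≤ n (^-monoˡ-≤ q m≤nn) ⟩
    n * nn ^ q                      ∎)))
  where
  open ≤-Reasoning
  nn = n * n

powerBound⇒density : ∀ n m s .{{_ : NonZero n}} → m ≤ n * n →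
  2 * (2 * (n * n)) ^ (2 + s) ≤ n * m ^ (2 + s) → 2 ^ (3 + s) * (n * (n * n)) ≤ m * m
powerBound⇒density n m s m≤nn powerBound =
  *-cancelʳ-≤ _ _ (n * nn ^ s) {{m*n≢0 n (nn ^ s)}} (begin
    2 ^ (3 + s) * (n * nn) * (n * nn ^ s)
  ≡⟨ regroup (2 ^ s) n (nn ^ s) ⟩
    2 * (2 ^ (2 + s) * (nn * (nn * nn ^ s)))
  ≡⟨ cong (2 *_) (sym (^-distrib-* 2 nn (2 + s))) ⟩
    2 * (2 * nn) ^ (2 + s)
  ≤⟨ powerBound ⟩
    n * (m * (m * m ^ s))
  ≤⟨ *-monoʳ-≤ n (*-monoʳ-≤ m (*-monoʳ-≤ m (^-monoˡ-≤ s m≤nn))) ⟩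
    n * (m * (m * nn ^ s))
  ≡⟨ rotate n m (nn ^ s) ⟩
    m * m * (n * nn ^ s)
  ∎)
  where
  open ≤-Reasoning
  nn = n * n
  instance
    nnˢ≢0 : NonZero (nn ^ s)
    nnˢ≢0 = m^n≢0 nn s {{m*n≢0 n n}}
  regroup : ∀ P n Q → 2 * (2 * (2 * P)) * (n * (n * n)) * (n * Q) ≡ 2 * (2 * (2 * P) * (n * n * (n * n * Q)))
  regroup = solve-∀
  rotate : ∀ n m Q → n * (m * (m * Q)) ≡ m * m * (n * Q)
  rotate = solve-∀

8q²≤[7q+1]2^[q+1] : ∀ q → 8 * (q * q) ≤ (7 * q + 1) * (2 * 2 ^ q)
8q²≤[7q+1]2^[q+1] q = begin
    8 * (q * q)                        ≤⟨ *-monoʳ-≤ 8 (*-monoʳ-≤ q (<⇒≤ (n<2^n q))) ⟩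
    8 * (q * 2 ^ q)                    ≤⟨ *-monoˡ-≤ (q * 2 ^ q) (≤ᵇ⇒≤ 8 14 _) ⟩
    14 * (q * 2 ^ q)                   ≤⟨ m≤m+n (14 * (q * 2 ^ q)) (2 * 2 ^ q) ⟩
    14 * (q * 2 ^ q) + 2 * 2 ^ q       ≡⟨ regroup q (2 ^ q) ⟩
    (7 * q + 1) * (2 * 2 ^ q)          ∎
  where
  open ≤-Reasoning
  regroup : ∀ q b → 14 * (q * b) + 2 * b ≡ (7 * q + 1) * (2 * b)
  regroup = solve-∀

-- 8q²n³ ≤ (7q+1)m²: for q = 1 this is the hypothesis m² ≥ 9n³, for
-- q ≥ 2 it follows from m² ≥ 2^(q+1)n³.
q²-density : ∀ n m q .{{_ : NonZero n}} → m ≤ n * n → 9 * (n * n * n) ≤ m * m →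
  2 * (2 * (n * n)) ^ q ≤ n * m ^ q → 8 * (q * q) * (n * n * n) ≤ (7 * q + 1) * (m * m)
q²-density n m zero          m≤nn dense powerBound = z≤n
q²-density n m 1             m≤nn dense powerBound =
  ≤-trans (*-monoˡ-≤ (n * n * n) (≤ᵇ⇒≤ 8 9 _)) (≤-trans dense (m≤n*m (m * m) 8))
q²-density n m (suc (suc s)) m≤nn dense powerBound = begin
    8 * (q * q) * (n * n * n)
  ≤⟨ *-monoˡ-≤ (n * n * n) (8q²≤[7q+1]2^[q+1] q) ⟩
    (7 * q + 1) * (2 * 2 ^ q) * (n * n * n)
  ≡⟨ regroup (7 * q + 1) (2 * 2 ^ q) n ⟩
    (7 * q + 1) * (2 ^ (3 + s) * (n * (n * n)))
  ≤⟨ *-monoʳ-≤ (7 * q + 1) (powerBound⇒density n m s m≤nn powerBound) ⟩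
    (7 * q + 1) * (m * m)
  ∎
  where
  q = suc (suc s)
  open ≤-Reasoning
  regroup : ∀ a b n → a * b * (n * n * n) ≡ a * (b * (n * (n * n)))
  regroup = solve-∀

-- 8r² ≤ (7q+1)n, from r ≤ qn²/m and 8q²n³ ≤ (7q+1)m².
r²-bound : ∀ n m q r .{{_ : NonZero n}} .{{_ : NonZero m}} → m ≤ n * n → 9 * (n * n * n) ≤ m * m →
  r * m ≤ q * (n * n) → 2 * (2 * (n * n)) ^ q ≤ n * m ^ q → 8 * (r * r) ≤ (7 * q + 1) * n
r²-bound n m q r m≤nn dense rm≤ powerBound = *-cancelʳ-≤ _ _ (m * m) {{m*n≢0 m m}} (begin
    8 * (r * r) * (m * m)                    ≡⟨ square r m ⟩
    8 * ((r * m) * (r * m))                  ≤⟨ *-monoʳ-≤ 8 (*-mono-≤ rm≤ rm≤) ⟩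
    8 * ((q * (n * n)) * (q * (n * n)))      ≡⟨ expand q n ⟩
    n * (8 * (q * q) * (n * n * n))          ≤⟨ *-monoʳ-≤ n (q²-density n m q m≤nn dense powerBound) ⟩
    n * ((7 * q + 1) * (m * m))              ≡⟨ reassociate n (7 * q + 1) (m * m) ⟩
    (7 * q + 1) * n * (m * m)                ∎)
  where
  open ≤-Reasoning
  square : ∀ r m → 8 * (r * r) * (m * m) ≡ 8 * ((r * m) * (r * m))
  square = solve-∀
  expand : ∀ q n → 8 * ((q * (n * n)) * (q * (n * n))) ≡ n * (8 * (q * q) * (n * n * n))
  expand = solve-∀
  reassociate : ∀ a b c → a * (b * c) ≡ b * a * c
  reassociate = solve-∀

-- If m² > 64n³ and n ≥ 16 then e^1 ≤ n m/(4n²) and e² ≤ n m²/(8n⁴)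
-- (as e ≤ e² ≤ 8), so the defining maximality of q forces q ≥ 2.
q≥2 : ∀ n m q → 16 ≤ n → 64 * (n * n * n) < m * m →
  ¬ ExpLe (suc q) (n * m ^ suc q) (2 * (2 * (n * n)) ^ suc q) → 2 ≤ q
q≥2 n m (suc (suc q)) 16≤n dense notExpLe = s≤s (s≤s z≤n)
q≥2 n m zero          16≤n dense notExpLe = ⊥-elim (notExpLe e≤)
  where
  open ≤-Reasoning
  32n≤m : 32 * n ≤ m
  32n≤m with 32 * n ≤? m
  ... | yes 32n≤m = 32n≤m
  ... | no  32n≰m = ⊥-elim (<-irrefl refl (<-≤-trans dense (begin
      m * m                   ≤⟨ *-mono-≤ m≤32n m≤32n ⟩
      32 * n * (32 * n)       ≡⟨ regroup n ⟩
      64 * (16 * (n * n))     ≤⟨ *-monoʳ-≤ 64 (*-monoˡ-≤ (n * n) 16≤n) ⟩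
      64 * (n * (n * n))      ≡⟨ cong (64 *_) (sym (*-assoc n n n)) ⟩
      64 * (n * n * n)        ∎)))
    where
    m≤32n : m ≤ 32 * n
    m≤32n = <⇒≤ (≰⇒> 32n≰m)
    regroup : ∀ n → 32 * n * (32 * n) ≡ 64 * (16 * (n * n))
    regroup = solve-∀
  e≤ : ExpLe 1 (n * m ^ 1) (2 * (2 * (n * n)) ^ 1)
  e≤ N = begin
      2 * (2 * (n * n) * 1) * T 1 N   ≤⟨ *-monoʳ-≤ (2 * (2 * (n * n) * 1)) (≤-trans (T-monoˡ N (s≤s z≤n)) (T2≤8! N)) ⟩
      2 * (2 * (n * n) * 1) * (8 * N !) ≡⟨ regroup n (N !) ⟩
      n * (32 * n) * N !              ≤⟨ *-monoˡ-≤ (N !) (*-monoʳ-≤ n (≤-trans 32n≤m (≤-reflexive (sym (*-identityʳ m))))) ⟩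
      n * (m * 1) * N !               ∎
    where
    regroup : ∀ n f → 2 * (2 * (n * n) * 1) * (8 * f) ≡ n * (32 * n) * f
    regroup = solve-∀
q≥2 n m 1             16≤n dense notExpLe = ⊥-elim (notExpLe e²≤)
  where
  open ≤-Reasoning
  e²≤ : ExpLe 2 (n * m ^ 2) (2 * (2 * (n * n)) ^ 2)
  e²≤ N = begin
      2 * (2 * (n * n) * (2 * (n * n) * 1)) * T 2 N
    ≤⟨ *-monoʳ-≤ (2 * (2 * (n * n) * (2 * (n * n) * 1))) (T2≤8! N) ⟩
      2 * (2 * (n * n) * (2 * (n * n) * 1)) * (8 * N !)
    ≡⟨ regroup n (N !) ⟩
      n * (64 * (n * n * n)) * N !
    ≤⟨ *-monoˡ-≤ (N !) (*-monoʳ-≤ n (≤-trans (<⇒≤ dense) (≤-reflexive (cong (m *_) (sym (*-identityʳ m)))))) ⟩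
      n * (m * (m * 1)) * N !
    ∎
    where
    regroup : ∀ n f → 2 * (2 * (n * n) * (2 * (n * n) * 1)) * (8 * f) ≡ n * (64 * (n * n * n)) * f
    regroup = solve-∀

crossEdges-lower : ∀ n m q r S S_R E → q * (n * n) < suc r * m → 2 * m ≤ S → S ≤ n * n →
  r * S ≤ n * S_R → S_R ≤ E + r * r → 2 * (q * (n * n)) + 2 ≤ n * E + n * (r * r) + n * n
crossEdges-lower n m q r S S_R E qnn<[r+1]m 2m≤S S≤nn average S_R≤ = begin
    2 * (q * (n * n)) + 2          ≡⟨ double (q * (n * n)) ⟩
    2 * suc (q * (n * n))          ≤⟨ *-monoʳ-≤ 2 qnn<[r+1]m ⟩
    2 * (suc r * m)                ≡⟨ split r m ⟩
    r * (2 * m) + 2 * m            ≤⟨ +-mono-≤ (*-monoʳ-≤ r 2m≤S) (≤-trans 2m≤S S≤nn) ⟩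
    r * S + n * n                  ≤⟨ +-monoˡ-≤ (n * n) (≤-trans average (*-monoʳ-≤ n S_R≤)) ⟩
    n * (E + r * r) + n * n        ≡⟨ cong (_+ n * n) (*-distribˡ-+ n E (r * r)) ⟩
    n * E + n * (r * r) + n * n    ∎
  where
  open ≤-Reasoning
  double : ∀ x → 2 * x + 2 ≡ 2 * suc x
  double = solve-∀
  split : ∀ r m → 2 * (suc r * m) ≡ r * (2 * m) + 2 * m
  split = solve-∀

crossEdges-large : ∀ n p r E → 2 * (suc p * (n * n)) + 2 ≤ n * E + n * (r * r) + n * n →
  8 * (r * r) ≤ (7 * suc p + 1) * n → 9 * p * n < 8 * E
crossEdges-large n p r E lower 8r²≤ = *-cancelˡ-< n (9 * p * n) (8 * E) (begin
    suc (n * (9 * p * n))          ≡⟨ +-comm 1 (n * (9 * p * n)) ⟩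
    n * (9 * p * n) + 1            ≤⟨ +-monoʳ-≤ (n * (9 * p * n)) (≤ᵇ⇒≤ 1 16 _) ⟩
    n * (9 * p * n) + 16           ≤⟨ +-cancelʳ-≤ (7 * p * nn + 16 * nn) _ _ scaled ⟩
    n * (8 * E)                    ∎)
  where
  open ≤-Reasoning
  nn = n * n
  scaled : n * (9 * p * n) + 16 + (7 * p * nn + 16 * nn) ≤ n * (8 * E) + (7 * p * nn + 16 * nn)
  scaled = begin
      n * (9 * p * n) + 16 + (7 * p * nn + 16 * nn)    ≡⟨ expand n p ⟩
      8 * (2 * (suc p * nn) + 2)                       ≤⟨ *-monoʳ-≤ 8 lower ⟩
      8 * (n * E + n * (r * r) + nn)                   ≡⟨ distribute n E (r * r) ⟩
      n * (8 * E) + n * (8 * (r * r)) + 8 * nn         ≤⟨ +-monoˡ-≤ (8 * nn) (+-monoʳ-≤ (n * (8 * E)) (*-monoʳ-≤ n 8r²≤)) ⟩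
      n * (8 * E) + n * ((7 * suc p + 1) * n) + 8 * nn ≡⟨ collect n p E ⟩
      n * (8 * E) + (7 * p * nn + 16 * nn)             ∎
    where
    expand : ∀ n p → n * (9 * p * n) + 16 + (7 * p * (n * n) + 16 * (n * n)) ≡ 8 * (2 * (suc p * (n * n)) + 2)
    expand = solve-∀
    distribute : ∀ n E x → 8 * (n * E + n * x + n * n) ≡ n * (8 * E) + n * (8 * x) + 8 * (n * n)
    distribute = solve-∀
    collect : ∀ n p E → n * (8 * E) + n * ((7 * suc p + 1) * n) + 8 * (n * n) ≡ n * (8 * E) + (7 * p * (n * n) + 16 * (n * n))
    collect = solve-∀

stars-exceed : ∀ n p E s c → 9 * p * n < 8 * E → E ≤ s + n * p → 8 * (p * c) ≤ p * n → p * c < s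
stars-exceed n p E s c 9pn<8E E≤s+np 8pc≤pn = *-cancelˡ-< 8 (p * c) s (≤-<-trans 8pc≤pn pn<8s)
  where
  pn<8s : p * n < 8 * s
  pn<8s = +-cancelʳ-< (8 * (n * p)) (p * n) (8 * s)
    (subst₂ _<_ (split p n) (*-distribˡ-+ 8 s (n * p)) (<-≤-trans 9pn<8E (*-monoʳ-≤ 8 E≤s+np)))
    where
    split : ∀ p n → 9 * p * n ≡ p * n + 8 * (n * p)
    split = solve-∀

eightfold : ∀ n p c → c * 2 ^ suc (suc p) ≤ n → 8 * (p * c) ≤ p * n
eightfold n zero    c c2^q≤n = z≤n
eightfold n (suc p) c c2^q≤n = begin
    8 * (suc p * c)                       ≡⟨ rotate (suc p) c ⟩
    suc p * (c * 8)                       ≤⟨ *-monoʳ-≤ (suc p) (*-monoʳ-≤ c 8≤2^[p+3]) ⟩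
    suc p * (c * 2 ^ suc (suc (suc p)))   ≤⟨ *-monoʳ-≤ (suc p) c2^q≤n ⟩
    suc p * n                             ∎
  where
  open ≤-Reasoning
  rotate : ∀ a b → 8 * (a * b) ≡ a * (b * 8)
  rotate = solve-∀
  8≤2^[p+3] : 8 ≤ 2 ^ suc (suc (suc p))
  8≤2^[p+3] = ^-monoʳ-≤ 2 {3} {suc (suc (suc p))} (s≤s (s≤s (s≤s z≤n)))

cost≤4n³ : ∀ n r q .{{_ : NonZero n}} → choose r q ≤ n → q ≤ n → findBipartiteCost n r q ≤ 4 * n ^ 3
cost≤4n³ n r q choose≤n q≤n = begin
    n * n + n * n + (r Comb.C q) * (q * n + n)
  ≡⟨ cong (λ c → n * n + n * n + c * (q * n + n)) (sym (choose≡C r q)) ⟩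
    n * n + n * n + choose r q * (q * n + n)
  ≤⟨ +-monoʳ-≤ (n * n + n * n) (*-mono-≤ choose≤n (+-monoˡ-≤ n (*-monoˡ-≤ n q≤n))) ⟩
    n * n + n * n + n * (n * n + n)
  ≤⟨ +-mono-≤ (+-mono-≤ nn≤nnn nn≤nnn) (*-monoʳ-≤ n (+-monoʳ-≤ (n * n) n≤nn)) ⟩
    n * (n * n) + n * (n * n) + n * (n * n + n * n)
  ≡⟨ collect n ⟩
    4 * n ^ 3
  ∎
  where
  open ≤-Reasoning
  n≤nn : n ≤ n * n
  n≤nn = m≤m*n n n
  nn≤nnn : n * n ≤ n * (n * n)
  nn≤nnn = *-monoʳ-≤ n n≤nn
  collect : ∀ n → n * (n * n) + n * (n * n) + n * (n * n + n * n) ≡ 4 * (n * (n * (n * 1)))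
  collect = solve-∀

dense⇒m≢0 : ∀ n m .{{_ : NonZero n}} → 9 * (n * n * n) ≤ m * m → NonZero m
dense⇒m≢0 n (suc m) _     = _
dense⇒m≢0 n zero    dense =
  ⊥-elim (≢-nonZero⁻¹ (9 * (n * n * n)) {{m*n≢0 9 (n * n * n) {{_}} {{m*n≢0 (n * n) n {{m*n≢0 n n}}}}}} (n≤0⇒n≡0 dense))

findBipartite-succeeds : ∀ {n} (G : Graph n) p r (R : Subset n) .{{_ : NonZero n}} .{{_ : NonZero (edgeCount G)}} →
  9 * (n * n * n) ≤ edgeCount G * edgeCount G → IsQ n (edgeCount G) (suc p) → IsR n (edgeCount G) (suc p) r →
  IsTopDegreeSet G r R → FindBipartiteReturns G (suc p) R
findBipartite-succeeds {n} G p .(∣ R ∣) R dense (expLe , _) (rm≤ , qnn<[r+1]m) (refl , dominates) =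
  bipartite-from-stars G R p
    (stars-exceed n p (crossEdges G R) (stars G R (suc p)) (choose ∣ R ∣ (suc p))
      (crossEdges-large n p ∣ R ∣ (crossEdges G R)
        (crossEdges-lower n m (suc p) ∣ R ∣ _ _ _ qnn<[r+1]m (handshake G) (degreeSum≤ G)
          (topAverage R (degree G) dominates) (degreeInR≤ G R))
        (r²-bound n m (suc p) ∣ R ∣ (edgeCount≤n² G) dense rm≤ (expLe⇒≤ expLe)))
      (crossEdges≤stars G R p)
      (eightfold n p _ (choose-r-q-bound n m (suc p) ∣ R ∣ rm≤ expLe)))
  where
  m = edgeCount G

theorem1 :
  ∃[ c ] ∃[ k ] ∃[ N ] ∀ n → N ≤ n →
    (G : Graph n) → ∀ m q r (R : Subset n) →
    edgeCount G ≡ m →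
    9 * (n * n * n) ≤ m * m →
    IsQ n m q → IsR n m q r → IsTopDegreeSet G r R →
      FindBipartiteReturns G q R ×
      (64 * (n * n * n) < m * m → 2 ≤ q) ×
      findBipartiteCost n r q ≤ c * n ^ k
theorem1 = 4 , 3 , 16 , correct
  where
  correct : ∀ n → 16 ≤ n → (G : Graph n) → ∀ m q r (R : Subset n) → edgeCount G ≡ m →
    9 * (n * n * n) ≤ m * m → IsQ n m q → IsR n m q r → IsTopDegreeSet G r R →
    FindBipartiteReturns G q R × (64 * (n * n * n) < m * m → 2 ≤ q) × findBipartiteCost n r q ≤ 4 * n ^ 3
  correct n 16≤n G .(edgeCount G) q r R refl dense (expLe , notExpLe) (rm≤ , qnn<[r+1]m) top =
    returns q (expLe , notExpLe) (rm≤ , qnn<[r+1]m) ,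
    (λ denser → q≥2 n m q 16≤n denser notExpLe) ,
    cost≤4n³ n r q choose≤n (q≤n n m q (edgeCount≤n² G) (expLe⇒≤ expLe))
    where
    m = edgeCount G
    instance
      n≢0 : NonZero n
      n≢0 = >-nonZero (≤-trans (s≤s z≤n) 16≤n)
      m≢0 : NonZero m
      m≢0 = dense⇒m≢0 n m dense
    returns : ∀ q → IsQ n m q → IsR n m q r → FindBipartiteReturns G q R
    returns zero    _   _   = findBipartite-q0 G R
    returns (suc p) isQ isR = findBipartite-succeeds G p r R dense isQ isR top
    choose≤n : choose r q ≤ n
    choose≤n = ≤-trans (m≤m*n (choose r q) (2 ^ suc q) {{m^n≢0 2 (suc q)}}) (choose-r-q-bound n m q r rm≤ expLe)
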